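{- Let $L$ be a frame and $I$ an interpretation with values in $L$ and nonempty domain $D$; let $X$ be the set of all sequences over $D$. For each geometric formula $\phi$ define $ext([\phi]):X\to L$ by $ext([\phi])(s)=gr(s\ \mathrm{sat}\ \phi)$. Then the collection $ext(A/_{\approx})=\{ext([\phi])\mid\phi \text{ a geometric formula}\}$ is an $L$-topology on $X$; moreover $ext([\phi])\cap ext([\psi])=ext([\phi\wedge\psi])$ and $\bigcup_i ext([\phi_i])=ext([\bigvee\{\phi_i\}_i])$.
   Context: A frame is a complete lattice $L$ (bottom $0_L$, top $1_L$) with $x\wedge\bigvee Y=\bigvee\{x\wedge y\mid y\in Y\}$. Language: constants $c_i$, variables $x_1,x_2,\dots$, $\top,\bot$, predicate symbols $p^i_j$, function symbols $f^i_j$, identity $=$. Terms: constants, variables, $f^i_jt_1\dots t_i$. Geometric formulae: $\top$, $\bot$, $p^i_jt_1\dots t_i$, $(t=t')$, $(\phi\wedge\psi)$, $\bigvee\{\phi_i\}_{i\in I}$ for any indexed family, $\exists x_i\phi$. An interpretation $I$: a set $D$, $I(c_i)\in D$, $I(f^i_j):D^i\to D$, $I(p^i_j):D^i\to L$. Sequences $s=(s_1,s_2,\dots)$ over $D$; term evaluation $s(c_i)=I(c_i)$, $s(x_k)=s_k$, $s(f^i_jt_1\dots t_i)=I(f^i_j)(s(t_1),\dots,s(t_i))$. Grade $gr(s\ \mathrm{sat}\ \phi)\in L$: atomic predicate gives $I(p^i_j)(s(t_1),\dots)$; $\top\mapsto1_L$; $\bot\mapsto0_L$; $t=t'\mapsto1_L$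 if $s(t)=s(t')$ else $0_L$; $\wedge\mapsto$ meet; $\bigvee\{\phi_i\}\mapsto\sup_i$; $\exists x_k\phi\mapsto\sup_{d\in D}gr(s(d/x_k)\ \mathrm{sat}\ \phi)$, where $s(d/x_k)$ replaces the $k$-th coordinate by $d$. $[\phi]$ denotes the class of $\phi$ under $\phi\approx\psi$ iff $gr(s\ \mathrm{sat}\ \phi)=gr(s\ \mathrm{sat}\ \psi)$ for all $s\in X$ (so $ext$ is well defined). An $L$-topology on $X$ is a collection $\tau$ of maps $X\to L$ containing the constant maps $0_L$ and $1_L$, closed under arbitrary unions $(\bigcup_i\tilde A_i)(x)=\sup_i\tilde A_i(x)$ and binary intersections $(\tilde A_1\cap\tilde A_2)(x)=\tilde A_1(x)\wedge\tilde A_2(x)$. -}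

module Defs where

open import Level using (Level; _⊔_) renaming (suc to lsuc)
open import Data.Nat using (ℕ; _≟_)
open import Data.Vec using (Vec; []; _∷_)
open import Data.Product using (Σ; _×_; _,_)
open import Relation.Nullary using (yes; no)
open import Relation.Binary using (IsPartialOrder)
open import Relation.Binary.PropositionalEquality using (_≡_)

record Frame (ι c ℓ₁ ℓ₂ : Level) : Set (lsuc (ι ⊔ c ⊔ ℓ₁ ⊔ ℓ₂)) where
  infixr 7 _∧_
  infix 4 _≈_ _≤_
  field
    Carrier        : Set c
    _≈_            : Carrier → Carrier → Set ℓ₁
    _≤_            : Carrier → Carrier → Set ℓ₂
    isPartialOrder : IsPartialOrder _≈_ _≤_
    ⋁              : {I : Set ι} → (I → Carrier) → Carrier
    ⋁-upper        : {I : Set ι} (f : I → Carrier) (i : I) → f i ≤ ⋁ f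
    ⋁-least        : {I : Set ι} (f : I → Carrier) (z : Carrier) →
                     (∀ i → f i ≤ z) → ⋁ f ≤ z
    ⋀              : {I : Set ι} → (I → Carrier) → Carrier
    ⋀-lower        : {I : Set ι} (f : I → Carrier) (i : I) → ⋀ f ≤ f i
    ⋀-greatest     : {I : Set ι} (f : I → Carrier) (z : Carrier) →
                     (∀ i → z ≤ f i) → z ≤ ⋀ f
    0L             : Carrier
    1L             : Carrier
    0L-least       : ∀ x → 0L ≤ x
    1L-greatest    : ∀ x → x ≤ 1L
    _∧_            : Carrier → Carrier → Carrier
    ∧-lowerˡ       : ∀ x y → x ∧ y ≤ x
    ∧-lowerʳ       : ∀ x y → x ∧ y ≤ y
    ∧-greatest     : ∀ x y z → z ≤ x → z ≤ y → z ≤ x ∧ y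
    ∧-distrib-⋁    : ∀ x {I : Set ι} (f : I → Carrier) →
                     x ∧ ⋁ f ≈ ⋁ (λ i → x ∧ f i)

-- The language.  Constants c_i, variables x_k, function symbols f^i_j
-- (arity i), predicate symbols p^i_j (arity i), all indexed by ℕ.

data Term : Set where
  const : ℕ → Term
  var   : ℕ → Term
  fun   : (i j : ℕ) → Vec Term i → Term

data GeoFormula (ι : Level) : Set (lsuc ι) where
  ⊤f   : GeoFormula ι
  ⊥f   : GeoFormula ι
  pred : (i j : ℕ) → Vec Term i → GeoFormula ι
  _≐_  : Term → Term → GeoFormula ι
  _∧f_ : GeoFormula ι → GeoFormula ι → GeoFormula ι
  ⋁f   : {I : Set ι} → (I → GeoFormula ι) → GeoFormula ι
  ∃f   : ℕ → GeoFormula ι → GeoFormula ι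

module _ {ι c ℓ₁ ℓ₂ : Level} (L : Frame ι c ℓ₁ ℓ₂) where
  open Frame L

  record Interpretation : Set (lsuc ι ⊔ c) where
    field
      D     : Set ι
      constI : ℕ → D
      funI  : (i j : ℕ) → Vec D i → D
      predI : (i j : ℕ) → Vec D i → Carrier

  module _ (I : Interpretation) where
    open Interpretation I

    Seq : Set ι
    Seq = ℕ → D

    update : Seq → ℕ → D → Seq
    update s k d n with n ≟ k
    ... | yes _ = d
    ... | no  _ = s n

    mutual
      evalTerm : Seq → Term → D
      evalTerm s (const i)   = constI i
      evalTerm s (var k)     = s k
      evalTerm s (fun i j ts) = funI i j (evalTerms s ts)

      evalTerms : ∀ {n} → Seq → Vec Term n → Vec D n
      evalTerms s []       = []
      evalTerms s (t ∷ ts) = evalTerm s t ∷ evalTerms s ts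

    -- gr(s sat φ).  For t = t' the grade is the join of 1_L over all
    -- proofs of s(t) = s(t'), i.e. 1_L if s(t) = s(t') and 0_L otherwise.
    gr : Seq → GeoFormula ι → Carrier
    gr s ⊤f           = 1L
    gr s ⊥f           = 0L
    gr s (pred i j ts) = predI i j (evalTerms s ts)
    gr s (t ≐ t')     = ⋁ {I = evalTerm s t ≡ evalTerm s t'} (λ _ → 1L)
    gr s (φ ∧f ψ)     = gr s φ ∧ gr s ψ
    gr s (⋁f φs)      = ⋁ (λ i → gr s (φs i))
    gr s (∃f k φ)     = ⋁ (λ (d : D) → gr (update s k d) φ)

    -- ext([φ]) : X → L  (well defined on ≈-classes by definition of ≈)
    ext : GeoFormula ι → Seq → Carrier
    ext φ s = gr s φ

    extCollection : (Seq → Carrier) → Set (lsuc ι ⊔ ℓ₁)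
    extCollection A = Σ (GeoFormula ι) (λ φ → ∀ s → A s ≈ ext φ s)

  record IsLTopology {ℓ : Level} (X : Set ι) (τ : (X → Carrier) → Set ℓ)
         : Set (lsuc ι ⊔ c ⊔ ℓ) where
    field
      has-0 : τ (λ _ → 0L)
      has-1 : τ (λ _ → 1L)
      ⋃-closed : {J : Set ι} (A : J → X → Carrier) →
                 (∀ j → τ (A j)) → τ (λ x → ⋁ (λ j → A j x))
      ∩-closed : (A B : X → Carrier) → τ A → τ B → τ (λ x → A x ∧ B x)

-- The grade of φ ∧ ψ (of ⋁ φᵢ) is by definition the meet (join) of the grades of
-- the components, so ext turns ∧f and ⋁f into pointwise ∩ and ⋃; together with
-- ext ⊥f = 0_L and ext ⊤f = 1_L, and since meets and joins respect ≈, the image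
-- of ext is an L-topology.
module Submission where

open import Defs
open import Level using (Level)
open import Data.Product using (_×_; _,_; proj₁; proj₂)
open import Relation.Binary using (IsPartialOrder)

module FrameProperties {ι c ℓ₁ ℓ₂ : Level} (L : Frame ι c ℓ₁ ℓ₂) where
  open Frame L
  open IsPartialOrder isPartialOrder

  ⋁-cong : {J : Set ι} {f g : J → Carrier} → (∀ j → f j ≈ g j) → ⋁ f ≈ ⋁ g
  ⋁-cong {f = f} {g} f≈g = antisym
    (⋁-least f (⋁ g) (λ j → trans (reflexive (f≈g j)) (⋁-upper g j)))
    (⋁-least g (⋁ f) (λ j → trans (reflexive (Eq.sym (f≈g j))) (⋁-upper f j)))

  ∧-mono : ∀ {a b a' b'} → a ≤ a' → b ≤ b' → a ∧ b ≤ a' ∧ b'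
  ∧-mono {a} {b} {a'} {b'} a≤a' b≤b' =
    ∧-greatest a' b' (a ∧ b) (trans (∧-lowerˡ a b) a≤a') (trans (∧-lowerʳ a b) b≤b')

  ∧-cong : ∀ {a b a' b'} → a ≈ a' → b ≈ b' → a ∧ b ≈ a' ∧ b'
  ∧-cong a≈a' b≈b' = antisym
    (∧-mono (reflexive a≈a') (reflexive b≈b'))
    (∧-mono (reflexive (Eq.sym a≈a')) (reflexive (Eq.sym b≈b')))

module ExtProperties {ι c ℓ₁ ℓ₂ : Level} (L : Frame ι c ℓ₁ ℓ₂)
                     (I : Interpretation L) where
  open Frame L
  open FrameProperties L
  open IsPartialOrder isPartialOrder using (module Eq)

  ext-∧f : (φ ψ : GeoFormula ι) (s : Seq L I) →
           ext L I φ s ∧ ext L I ψ s ≈ ext L I (φ ∧f ψ) s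
  ext-∧f φ ψ s = Eq.refl

  ext-⋁f : {J : Set ι} (φs : J → GeoFormula ι) (s : Seq L I) →
           ⋁ (λ j → ext L I (φs j) s) ≈ ext L I (⋁f φs) s
  ext-⋁f φs s = Eq.refl

  extCollection-isLTopology : IsLTopology L (Seq L I) (extCollection L I)
  extCollection-isLTopology = record
    { has-0    = ⊥f , λ s → Eq.refl
    ; has-1    = ⊤f , λ s → Eq.refl
    ; ⋃-closed = λ A A∈ext → let φs = λ j → proj₁ (A∈ext j) in ⋁f φs ,
        λ s → Eq.trans (⋁-cong (λ j → proj₂ (A∈ext j) s)) (ext-⋁f φs s)
    ; ∩-closed = λ A B (φ , A≈φ) (ψ , B≈ψ) → φ ∧f ψ ,
        λ s → Eq.trans (∧-cong (A≈φ s) (B≈ψ s)) (ext-∧f φ ψ s)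
    }

mainTheorem6 : {ι c ℓ₁ ℓ₂ : Level} (L : Frame ι c ℓ₁ ℓ₂)
               (I : Interpretation L) →
               Interpretation.D I →
               IsLTopology L (Seq L I) (extCollection L I)
               × (∀ (φ ψ : GeoFormula ι) (s : Seq L I) →
                    Frame._≈_ L (Frame._∧_ L (ext L I φ s) (ext L I ψ s))
                                (ext L I (φ ∧f ψ) s))
               × (∀ {J : Set ι} (φs : J → GeoFormula ι) (s : Seq L I) →
                    Frame._≈_ L (Frame.⋁ L (λ j → ext L I (φs j) s))
                                (ext L I (⋁f φs) s))
mainTheorem6 L I _ = extCollection-isLTopology , ext-∧f , ext-⋁f
  where open ExtProperties L I
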